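{- Let $p$ be a prime and identify $\mathbb{Z}/p\mathbb{Z}$ with $\{0,1,\dots,p-1\}$. Let $A,B\subseteq\mathbb{Z}/p\mathbb{Z}$ with $|A|,|B|\ge 2$, $p\ge |A|+|B|-2$, and $\max A+\max B<p$ (as integers). Then $|A\widehat{+}B|=|A|+|B|-3$ if and only if $A=B$ and one of the following holds: (1) $|A|=2$ or $|A|=3$; (2) $|A|=4$ and $A=\{a,a+d,c,c+d\}$ for some $a,c,d$; (3) $|A|\ge 5$ and $A$ is an arithmetic progression.
   Context: For $A,B\subseteq\mathbb{Z}/p\mathbb{Z}$, the restricted sumset is $A\widehat{+}B=\{a+b \bmod p: a\in A,\ b\in B,\ a\neq b\}$. -}

module Defs where

open import Data.Nat using (ℕ; zero; suc; _+_; _*_; _<_; _≤_)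
open import Data.Nat.DivMod using (_%_; m%n<n)
open import Data.Fin using (Fin; toℕ; fromℕ<; _≟_)
open import Data.Fin.Properties using (any?)
open import Data.Fin.Subset using (Subset; _∈_)
open import Data.Fin.Subset.Properties using (_∈?_)
open import Data.Vec using (tabulate)
open import Data.Bool using (Bool)
open import Data.Product using (Σ; ∃; ∃-syntax; _×_; _,_)
open import Data.Product.Properties using ()
open import Data.Sum using (_⊎_)
open import Relation.Nullary using (¬_; Dec; yes; no; _×-dec_; ¬?)
open import Relation.Nullary.Decidable using (does)
open import Relation.Binary.PropositionalEquality using (_≡_)
open import Function.Bundles using (_⇔_)

-- Z/pZ is represented by Fin p (identified with {0,...,p-1} via toℕ).
-- Reduction of a natural number modulo p, as an element of Fin p.
[_]ₚ : ∀ {p} → ℕ → Fin p → Fin p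
[_]ₚ {suc n} m _ = fromℕ< (m%n<n m (suc n))

_⊕_ : ∀ {p} → Fin p → Fin p → Fin p
a ⊕ b = [ toℕ a + toℕ b ]ₚ a

_⊕_·_ : ∀ {p} → Fin p → ℕ → Fin p → Fin p
a ⊕ i · d = [ toℕ a + i * toℕ d ]ₚ a

RSum : ∀ {p} → Subset p → Subset p → Fin p → Set
RSum A B x = ∃[ a ] ∃[ b ] (a ∈ A × b ∈ B × ¬ (a ≡ b) × a ⊕ b ≡ x)

RSum? : ∀ {p} (A B : Subset p) (x : Fin p) → Dec (RSum A B x)
RSum? A B x = any? λ a → any? λ b →
  (a ∈? A) ×-dec ((b ∈? B) ×-dec (¬? (a ≟ b) ×-dec ((a ⊕ b) ≟ x)))

_+̂_ : ∀ {p} → Subset p → Subset p → Subset p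
A +̂ B = tabulate λ x → does (RSum? A B x)

IsMax : ∀ {p} → Subset p → Fin p → Set
IsMax A m = m ∈ A × (∀ a → a ∈ A → toℕ a ≤ toℕ m)

IsTwoPairs : ∀ {p} → Subset p → Set
IsTwoPairs {p} A = ∃[ a ] ∃[ c ] ∃[ d ]
  (∀ (x : Fin p) → (x ∈ A) ⇔ (x ≡ a ⊎ x ≡ a ⊕ d ⊎ x ≡ c ⊎ x ≡ c ⊕ d))

IsAP : ∀ {p} → ℕ → Subset p → Set
IsAP {p} k A = ∃[ a ] ∃[ d ]
  (∀ (x : Fin p) → (x ∈ A) ⇔ (∃[ i ] (i < k × x ≡ a ⊕ i · d)))

module Submission where

-- Since max A + max B < p, no sum wraps around: A +̂ B is the restricted sumset of A and B as sets
-- of integers.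
--
-- With x = min A and M = max B, the restricted sums x + b (b ∈ B, b ≠ x) followed by a + M
-- (a ∈ A, x ≠ a ≠ M) increase strictly, so |A +̂ B| ≥ |A| + |B| − 3. At equality x ∈ B, M ∈ A and
-- every restricted sum lies on this chain; with the same facts for B and A this forces A = B.
-- For A = B = {x₁ < … < x_k}, a sum x₂ + b with b < x_k can then only be x₁ + c. For k = 4 this
-- gives x₂ + x₃ = x₁ + x₄; for k = 5 the relations x₂ + x₃ = x₁ + x₄, x₂ + x₄ = x₁ + x₅ and (as
-- removing x₁ keeps equality) x₃ + x₄ = x₂ + x₅ make A a progression; for k > 5, induction makes
-- x₂ < … < x_k a progression of difference d, and placing x₂ + x₃ and x₂ + x_{k−1} on the chain
-- gives x₂ − x₁ = d.

open import Defs

open import Data.Bool using (true; false)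
open import Data.Empty using (⊥-elim)
open import Data.Fin as Fin using (Fin; toℕ; fromℕ<)
open import Data.Fin.Properties using (toℕ-injective; toℕ-fromℕ<; toℕ<n)
open import Data.Fin.Subset as Subset using (Subset; ∣_∣) renaming (_∈_ to _∈ₛ_)
open import Data.Fin.Subset.Properties using (⊆-antisym)
open import Data.List using (List; []; _∷_; _++_; _∷ʳ_; map; length; filter; applyUpTo)
open import Data.List.Membership.Propositional using (_∈_; _∉_)
open import Data.List.Membership.Propositional.Properties
  using (∈-applyUpTo⁺; ∈-map⁺; ∈-map⁻; ∈-++⁺ˡ; ∈-++⁺ʳ; ∈-++⁻; ∈-filter⁺; ∈-filter⁻)
open import Data.List.Properties
  using (length-applyUpTo; length-++; length-map; filter-all; filter-notAll; filter-reject; filter-accept)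
open import Data.List.Relation.Binary.Subset.Propositional using (_⊆_)
open import Data.List.Relation.Unary.All as All using (All; []; _∷_)
import Data.List.Relation.Unary.All.Properties as All
open import Data.List.Relation.Unary.All.Properties using (¬Any⇒All¬)
open import Data.List.Relation.Unary.AllPairs as AllPairs using (AllPairs; []; _∷_)
import Data.List.Relation.Unary.AllPairs.Properties as AllPairs
open import Data.List.Relation.Unary.Any as Any using (here; there)
open import Data.List.Relation.Unary.Unique.Propositional using (Unique)
open import Data.Nat using (ℕ; zero; suc; _+_; _*_; _∸_; _≤_; _<_; _≥_; z≤n; s≤s; s≤s⁻¹; _≟_)
open import Data.List.Membership.DecPropositional _≟_ using (_∈?_)
open import Data.Nat.DivMod using (_%_; %-distribˡ-+; m%n%n≡m%n; m<n⇒m%n≡m)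
open import Data.Nat.Primality using (Prime)
open import Data.Nat.Properties
open import Data.Nat.Tactic.RingSolver using (solve-∀)
open import Data.Product using (_×_; ∃-syntax; _,_; proj₁; proj₂)
open import Data.Sum using (_⊎_; inj₁; inj₂)
open import Data.Vec using (_∷_; []; here; there)
open import Data.Vec.Properties using (lookup∘tabulate; []=⇒lookup; lookup⇒[]=)
open import Function using (_∘_)
open import Function.Bundles using (_⇔_; mk⇔; Equivalence)
open import Function.Properties.Equivalence using () renaming (trans to ⇔-trans)
open import Relation.Binary.Definitions using (tri<; tri≈; tri>)
open import Relation.Binary.PropositionalEquality
open import Relation.Nullary using (yes; no; ¬?; does; contradiction)
open import Relation.Nullary.Decidable using (dec-true)

-- Finite sets of naturals as strictly increasing lists

Sorted : List ℕ → Set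
Sorted = AllPairs _<_

sorted⇒unique : ∀ {xs} → Sorted xs → Unique xs
sorted⇒unique = AllPairs.map <⇒≢

sorted-head≤ : ∀ {x xs y} → Sorted (x ∷ xs) → y ∈ x ∷ xs → x ≤ y
sorted-head≤ _ (here refl) = ≤-refl
sorted-head≤ (x< ∷ _) (there y∈xs) = <⇒≤ (All.lookup x< y∈xs)

Maximum : List ℕ → ℕ → Set
Maximum xs M = M ∈ xs × All (_≤ M) xs

sorted-∷ʳ⇒maximum : ∀ xs {M} → Sorted (xs ∷ʳ M) → Maximum (xs ∷ʳ M) M
sorted-∷ʳ⇒maximum xs {M} sorted = ∈-++⁺ʳ xs (here refl) , below xs sorted
  where
  below : ∀ xs → Sorted (xs ∷ʳ M) → All (_≤ M) (xs ∷ʳ M)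
  below [] _ = ≤-refl ∷ []
  below (x ∷ xs) (x< ∷ sorted) = <⇒≤ (All.lookup x< (∈-++⁺ʳ xs (here refl))) ∷ below xs sorted

infixl 6 _∖_
_∖_ : List ℕ → ℕ → List ℕ
xs ∖ v = filter (λ y → ¬? (y ≟ v)) xs

∈-∖⁻ : ∀ xs {v y} → y ∈ xs ∖ v → y ∈ xs × y ≢ v
∈-∖⁻ _ = ∈-filter⁻ _

∈-∖⁺ : ∀ {xs v y} → y ∈ xs → y ≢ v → y ∈ xs ∖ v
∈-∖⁺ = ∈-filter⁺ _

length-∖-∉ : ∀ {xs v} → v ∉ xs → length (xs ∖ v) ≡ length xs
length-∖-∉ v∉xs = cong length (filter-all _ (All.tabulate λ y∈xs y≡v → v∉xs (subst (_∈ _) y≡v y∈xs)))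

length-∖-∈ : ∀ {xs v} → v ∈ xs → length (xs ∖ v) < length xs
length-∖-∈ {xs} v∈xs = filter-notAll _ xs (Any.map (λ v≡y y≢v → y≢v (sym v≡y)) v∈xs)

length-∖-unique : ∀ {xs} v → Unique xs → length xs ≤ suc (length (xs ∖ v))
length-∖-unique {[]} v _ = z≤n
length-∖-unique {x ∷ xs} v (x∉xs ∷ unique) with x ≟ v
... | yes refl = begin
  suc (length xs)              ≡⟨ cong suc (length-∖-∉ (λ x∈xs → All.lookup x∉xs x∈xs refl)) ⟨
  suc (length (xs ∖ x))        ≡⟨ cong (suc ∘ length) (filter-reject (λ y → ¬? (y ≟ x)) (λ x≢x → x≢x refl)) ⟨
  suc (length ((x ∷ xs) ∖ x))  ∎
  where open ≤-Reasoning
... | no x≢v = begin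
  suc (length xs)              ≤⟨ s≤s (length-∖-unique v unique) ⟩
  suc (length (x ∷ xs ∖ v))    ≡⟨ cong (suc ∘ length) (filter-accept (λ y → ¬? (y ≟ v)) x≢v) ⟨
  suc (length ((x ∷ xs) ∖ v))  ∎
  where open ≤-Reasoning

unique-⊆⇒length≤ : ∀ {xs ys : List ℕ} → Unique xs → xs ⊆ ys → length xs ≤ length ys
unique-⊆⇒length≤ {[]} _ _ = z≤n
unique-⊆⇒length≤ {x ∷ xs} {ys} (x∉xs ∷ unique) xs⊆ys =
  <-≤-trans (s≤s (unique-⊆⇒length≤ unique xs⊆ys∖x)) (length-∖-∈ (xs⊆ys (here refl)))
  where
  xs⊆ys∖x : xs ⊆ ys ∖ x
  xs⊆ys∖x y∈xs = ∈-∖⁺ (xs⊆ys (there y∈xs)) (λ y≡x → All.lookup x∉xs y∈xs (sym y≡x))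

≤-tight : ∀ {a b c d} → a ≤ c → b ≤ d → c + d ≤ a + b → a ≡ c × b ≡ d
≤-tight {a} {b} {c} {d} a≤c b≤d c+d≤a+b = ≤-antisym a≤c c≤a , ≤-antisym b≤d d≤b
  where
  c≤a : c ≤ a
  c≤a = ≮⇒≥ λ a<c → <⇒≱ (+-mono-<-≤ a<c b≤d) c+d≤a+b
  d≤b : d ≤ b
  d≤b = ≮⇒≥ λ b<d → <⇒≱ (+-mono-≤-< a≤c b<d) c+d≤a+b

x<y∧y+b≡x+c⇒b<c : ∀ {x y b c} → x < y → y + b ≡ x + c → b < c
x<y∧y+b≡x+c⇒b<c x<y y+b≡x+c = ≰⇒> λ c≤b → <⇒≢ (+-mono-<-≤ x<y c≤b) (sym y+b≡x+c)

same-difference : ∀ {a b c d e} → a ≡ c + d → a + b ≡ c + e → e ≡ b + d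
same-difference {b = b} {c} {d} {e} refl c+d+b≡c+e = +-cancelˡ-≡ c e (b + d) (begin
  c + e        ≡⟨ c+d+b≡c+e ⟨
  c + d + b    ≡⟨ +-assoc c d b ⟩
  c + (d + b)  ≡⟨ cong (c +_) (+-comm d b) ⟩
  c + (b + d)  ∎)
  where open ≡-Reasoning

RestrictedSum : List ℕ → List ℕ → ℕ → Set
RestrictedSum xs ys n = ∃[ a ] ∃[ b ] (a ∈ xs × b ∈ ys × a ≢ b × n ≡ a + b)

restrictedSum-comm : ∀ {xs ys n} → RestrictedSum xs ys n → RestrictedSum ys xs n
restrictedSum-comm (a , b , a∈xs , b∈ys , a≢b , n≡a+b) =
  b , a , b∈ys , a∈xs , a≢b ∘ sym , trans n≡a+b (+-comm a b)

restrictedSum-⊆ : ∀ {xs xs′ ys ys′ n} → xs ⊆ xs′ → ys ⊆ ys′ → RestrictedSum xs ys n → RestrictedSum xs′ ys′ n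
restrictedSum-⊆ xs⊆ ys⊆ (a , b , a∈ , b∈ , a≢b , n≡a+b) = a , b , xs⊆ a∈ , ys⊆ b∈ , a≢b , n≡a+b

restrictedSum-≥ : ∀ {y z r s} → Sorted (y ∷ z ∷ r) → RestrictedSum (y ∷ z ∷ r) (y ∷ z ∷ r) s → y + z ≤ s
restrictedSum-≥ sorted (a , b , here refl , here refl , a≢b , _) = contradiction refl a≢b
restrictedSum-≥ sorted (a , b , here refl , there b∈ , _ , refl) = +-monoʳ-≤ a (sorted-head≤ (AllPairs.tail sorted) b∈)
restrictedSum-≥ {y} {z} sorted (a , b , there a∈ , b∈ , _ , refl) =
  subst (_≤ a + b) (+-comm z y) (+-mono-≤ (sorted-head≤ (AllPairs.tail sorted) a∈) (sorted-head≤ sorted b∈))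

-- |xs +̂ ys| ≤ |xs| + |ys| − 3, stated without computing the sumset
Critical : List ℕ → List ℕ → Set
Critical xs ys = ∀ {L} → Unique L → All (RestrictedSum xs ys) L → length L + 3 ≤ length xs + length ys

critical-sym : ∀ {xs ys} → Critical xs ys → Critical ys xs
critical-sym {xs} {ys} critical {L} unique sums =
  subst (length L + 3 ≤_) (+-comm (length xs) (length ys)) (critical unique (All.map restrictedSum-comm sums))

chain : ℕ → List ℕ → List ℕ → ℕ → List ℕ
chain x xt ys M = map (x +_) (ys ∖ x) ++ map (_+ M) (xt ∖ M)

chain-sorted : ∀ {x xt ys M} → Sorted (x ∷ xt) → Sorted ys → All (_≤ M) ys → Sorted (chain x xt ys M)
chain-sorted {x} {xt} {ys} {M} (x<xt ∷ sorted-xt) sorted-ys ys≤M =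
  AllPairs.++⁺ (AllPairs.map⁺ (AllPairs.map (+-monoʳ-< x) (AllPairs.filter⁺ _ sorted-ys)))
               (AllPairs.map⁺ (AllPairs.map (+-monoˡ-< M) (AllPairs.filter⁺ _ sorted-xt)))
               (All.tabulate λ s∈ → All.tabulate λ t∈ → increasing (∈-map⁻ _ s∈) (∈-map⁻ _ t∈))
  where
  increasing : ∀ {s t} → ∃[ b ] (b ∈ ys ∖ x × s ≡ x + b) → ∃[ a ] (a ∈ xt ∖ M × t ≡ a + M) → s < t
  increasing (b , b∈ , refl) (a , a∈ , refl) =
    ≤-<-trans (+-monoʳ-≤ x (All.lookup ys≤M (proj₁ (∈-∖⁻ ys b∈)))) (+-monoˡ-< M (All.lookup x<xt (proj₁ (∈-∖⁻ xt a∈))))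

∈-chain⁻ : ∀ {x xt ys M s} → s ∈ chain x xt ys M →
  (∃[ b ] (b ∈ ys × b ≢ x × s ≡ x + b)) ⊎ (∃[ a ] (a ∈ xt × a ≢ M × s ≡ a + M))
∈-chain⁻ {x} {xt} {ys} {M} s∈ with ∈-++⁻ (map (x +_) (ys ∖ x)) s∈
... | inj₁ s∈₁ = let b , b∈ , s≡x+b = ∈-map⁻ (x +_) s∈₁ ; b∈ys , b≢x = ∈-∖⁻ ys b∈ in inj₁ (b , b∈ys , b≢x , s≡x+b)
... | inj₂ s∈₂ = let a , a∈ , s≡a+M = ∈-map⁻ (_+ M) s∈₂ ; a∈xt , a≢M = ∈-∖⁻ xt a∈ in inj₂ (a , a∈xt , a≢M , s≡a+M)

chain-sums : ∀ {x xt ys M} → M ∈ ys → All (RestrictedSum (x ∷ xt) ys) (chain x xt ys M)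
chain-sums {x} {xt} {ys} {M} M∈ys = All.tabulate (restricted ∘ ∈-chain⁻)
  where
  restricted : ∀ {s} → (∃[ b ] (b ∈ ys × b ≢ x × s ≡ x + b)) ⊎ (∃[ a ] (a ∈ xt × a ≢ M × s ≡ a + M)) →
               RestrictedSum (x ∷ xt) ys s
  restricted (inj₁ (b , b∈ys , b≢x , s≡x+b)) = x , b , here refl , b∈ys , b≢x ∘ sym , s≡x+b
  restricted (inj₂ (a , a∈xt , a≢M , s≡a+M)) = a , M , there a∈xt , M∈ys , a≢M , s≡a+M

length-chain : ∀ x xt ys M →
  length (chain x xt ys M) + 3 ≡ suc (suc (length (xt ∖ M)) + suc (length (ys ∖ x)))
length-chain x xt ys M = begin
  length (chain x xt ys M) + 3
    ≡⟨ cong (_+ 3) (length-++ (map (x +_) (ys ∖ x))) ⟩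
  length (map (x +_) (ys ∖ x)) + length (map (_+ M) (xt ∖ M)) + 3
    ≡⟨ cong₂ (λ m n → m + n + 3) (length-map (x +_) (ys ∖ x)) (length-map (_+ M) (xt ∖ M)) ⟩
  length (ys ∖ x) + length (xt ∖ M) + 3
    ≡⟨ arith (length (ys ∖ x)) (length (xt ∖ M)) ⟩
  suc (suc (length (xt ∖ M)) + suc (length (ys ∖ x)))
    ∎
  where
  open ≡-Reasoning
  arith : ∀ m n → m + n + 3 ≡ suc (suc n + suc m)
  arith = solve-∀

chain-lower : ∀ {x xt ys} M → Unique xt → Unique ys → length (x ∷ xt) + length ys ≤ length (chain x xt ys M) + 3
chain-lower {x} {xt} {ys} M unique-xt unique-ys = begin
  suc (length xt + length ys)
    ≤⟨ s≤s (+-mono-≤ (length-∖-unique M unique-xt) (length-∖-unique x unique-ys)) ⟩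
  suc (suc (length (xt ∖ M)) + suc (length (ys ∖ x)))
    ≡⟨ length-chain x xt ys M ⟨
  length (chain x xt ys M) + 3
    ∎
  where open ≤-Reasoning

restrictedSums-lower-bound : ∀ {xs ys M zs} → Sorted xs → Sorted ys → Maximum ys M → 0 < length xs →
  (∀ {s} → RestrictedSum xs ys s → s ∈ zs) → length xs + length ys ≤ length zs + 3
restrictedSums-lower-bound {x ∷ xt} {ys} {M} {zs} sorted-xs sorted-ys max _ sums⊆zs = begin
  length (x ∷ xt) + length ys   ≤⟨ chain-lower M (sorted⇒unique (AllPairs.tail sorted-xs)) (sorted⇒unique sorted-ys) ⟩
  length (chain x xt ys M) + 3  ≤⟨ +-monoˡ-≤ 3 (unique-⊆⇒length≤ unique-chain chain⊆zs) ⟩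
  length zs + 3                 ∎
  where
  open ≤-Reasoning
  unique-chain : Unique (chain x xt ys M)
  unique-chain = sorted⇒unique (chain-sorted sorted-xs sorted-ys (proj₂ max))
  chain⊆zs : chain x xt ys M ⊆ zs
  chain⊆zs s∈ = sums⊆zs (All.lookup (chain-sums (proj₁ max)) s∈)

module _ {x xt ys M} (sorted-xs : Sorted (x ∷ xt)) (sorted-ys : Sorted ys) (max-ys : Maximum ys M)
         (critical : Critical (x ∷ xt) ys) where

  private
    unique-xt : Unique xt
    unique-xt = sorted⇒unique (AllPairs.tail sorted-xs)

    unique-ys : Unique ys
    unique-ys = sorted⇒unique sorted-ys

    unique-chain : Unique (chain x xt ys M)
    unique-chain = sorted⇒unique (chain-sorted sorted-xs sorted-ys (proj₂ max-ys))

  critical⇒tight : length xt ≡ suc (length (xt ∖ M)) × length ys ≡ suc (length (ys ∖ x))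
  critical⇒tight = ≤-tight (length-∖-unique M unique-xt) (length-∖-unique x unique-ys)
    (s≤s⁻¹ (subst (_≤ length (x ∷ xt) + length ys) (length-chain x xt ys M)
                  (critical unique-chain (chain-sums (proj₁ max-ys)))))

  critical⇒min∈ : x ∈ ys
  critical⇒min∈ with x ∈? ys
  ... | yes x∈ys = x∈ys
  ... | no x∉ys = contradiction (sym (trans (proj₂ critical⇒tight) (cong suc (length-∖-∉ x∉ys)))) 1+n≢n

  critical⇒max∈ : M ∈ xt
  critical⇒max∈ with M ∈? xt
  ... | yes M∈xt = M∈xt
  ... | no M∉xt = contradiction (sym (trans (proj₁ critical⇒tight) (cong suc (length-∖-∉ M∉xt)))) 1+n≢n

  critical⇒∈chain : ∀ {s} → RestrictedSum (x ∷ xt) ys s → s ∈ chain x xt ys M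
  critical⇒∈chain {s} sum with s ∈? chain x xt ys M
  ... | yes s∈ = s∈
  ... | no s∉ = ⊥-elim (<⇒≱ (critical (¬Any⇒All¬ _ s∉ ∷ unique-chain) (sum ∷ chain-sums (proj₁ max-ys)))
                            (chain-lower M unique-xt unique-ys))

critical⇒⊆ : ∀ {xs ys N M} → Sorted xs → Sorted ys → Maximum xs N → Maximum ys M → Critical xs ys → xs ⊆ ys
critical⇒⊆ {x ∷ xt} {y ∷ yt} {N} {M} sorted-xs sorted-ys max-xs max-ys critical = xs⊆ys
  where
  critical′ : Critical (y ∷ yt) (x ∷ xt)
  critical′ = critical-sym critical

  x≡y : x ≡ y
  x≡y = ≤-antisym (sorted-head≤ sorted-xs (critical⇒min∈ sorted-ys sorted-xs max-xs critical′))
                  (sorted-head≤ sorted-ys (critical⇒min∈ sorted-xs sorted-ys max-ys critical))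

  N≤M : N ≤ M
  N≤M = All.lookup (proj₂ max-ys) (there (critical⇒max∈ sorted-ys sorted-xs max-xs critical′))

  y<xt : All (y <_) xt
  y<xt = subst (λ z → All (z <_) xt) x≡y (AllPairs.head sorted-xs)

  xs⊆ys : x ∷ xt ⊆ y ∷ yt
  xs⊆ys (here refl) = critical⇒min∈ sorted-xs sorted-ys max-ys critical
  xs⊆ys {a} (there a∈xt)
    with ∈-chain⁻ (critical⇒∈chain sorted-xs sorted-ys max-ys critical
                    (a , y , there a∈xt , here refl , >⇒≢ (All.lookup y<xt a∈xt) , refl))
  ... | inj₁ (b , b∈ys , _ , a+y≡x+b) =
    subst (_∈ y ∷ yt) (+-cancelʳ-≡ y b a (trans (+-comm b y) (trans (cong (_+ b) (sym x≡y)) (sym a+y≡x+b)))) b∈ys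
  ... | inj₂ (c , c∈xt , _ , a+y≡c+M) =
    contradiction a+y≡c+M (<⇒≢ (subst (a + y <_) (+-comm M c)
      (+-mono-≤-< (≤-trans (All.lookup (proj₂ max-xs) (there a∈xt)) N≤M) (All.lookup y<xt c∈xt))))

-- x + y and x + z lie below every restricted sum of y ∷ z ∷ r.
critical-tail : ∀ {x y z r} → Sorted (x ∷ y ∷ z ∷ r) →
  Critical (x ∷ y ∷ z ∷ r) (x ∷ y ∷ z ∷ r) → Critical (y ∷ z ∷ r) (y ∷ z ∷ r)
critical-tail {x} {y} {z} {r} sorted@((x<y ∷ x<z ∷ _) ∷ (y<z ∷ _) ∷ _) critical {L} unique sums =
  s≤s⁻¹ (s≤s⁻¹ (subst (suc (suc (length L + 3)) ≤_) (cong suc (+-suc k k)) (critical unique′ sums′)))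
  where
  k = length (y ∷ z ∷ r)

  L-above : All (x + z <_) L
  L-above = All.map (<-≤-trans (+-monoˡ-< z x<y) ∘ restrictedSum-≥ (AllPairs.tail sorted)) sums

  unique′ : Unique (x + y ∷ x + z ∷ L)
  unique′ = (<⇒≢ (+-monoʳ-< x y<z) ∷ All.map (<⇒≢ ∘ <-trans (+-monoʳ-< x y<z)) L-above)
          ∷ All.map <⇒≢ L-above ∷ unique

  sums′ : All (RestrictedSum (x ∷ y ∷ z ∷ r) (x ∷ y ∷ z ∷ r)) (x + y ∷ x + z ∷ L)
  sums′ = (x , y , here refl , there (here refl) , <⇒≢ x<y , refl)
        ∷ (x , z , here refl , there (there (here refl)) , <⇒≢ x<z , refl)
        ∷ All.map (restrictedSum-⊆ there there) sums

-- y + b lies below every a + M with a ∈ y ∷ yt, so on the chain it must be x + c.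
critical⇒y+b≡x+c : ∀ {x y yt M b} → Sorted (x ∷ y ∷ yt) → Maximum (x ∷ y ∷ yt) M →
  Critical (x ∷ y ∷ yt) (x ∷ y ∷ yt) → b ∈ yt → b < M → ∃[ c ] (c ∈ yt × b < c × y + b ≡ x + c)
critical⇒y+b≡x+c {x} {y} {yt} sorted@((x<y ∷ _) ∷ y<yt ∷ _) max critical b∈yt b<M
  with ∈-chain⁻ {ys = x ∷ y ∷ yt} (critical⇒∈chain sorted sorted max critical
         (y , _ , there (here refl) , there (there b∈yt) , <⇒≢ (All.lookup y<yt b∈yt) , refl))
... | inj₁ (c , here refl , c≢x , _) = contradiction refl c≢x
... | inj₁ (c , there (here refl) , _ , y+b≡x+y) =
  contradiction (x<y∧y+b≡x+c⇒b<c x<y y+b≡x+y) (<-asym (All.lookup y<yt b∈yt))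
... | inj₁ (c , there (there c∈yt) , _ , y+b≡x+c) = c , c∈yt , x<y∧y+b≡x+c⇒b<c x<y y+b≡x+c , y+b≡x+c
... | inj₂ (a , a∈ , _ , y+b≡a+M) =
  contradiction y+b≡a+M (<⇒≢ (+-mono-≤-< (sorted-head≤ (AllPairs.tail sorted) a∈) b<M))

critical⇒two-pairs : ∀ {m u v M} → Sorted (m ∷ u ∷ v ∷ M ∷ []) →
  Critical (m ∷ u ∷ v ∷ M ∷ []) (m ∷ u ∷ v ∷ M ∷ []) → u + v ≡ m + M
critical⇒two-pairs {m} {u} {v} sorted@(_ ∷ _ ∷ (v<M ∷ []) ∷ _) critical
  with critical⇒y+b≡x+c sorted (sorted-∷ʳ⇒maximum (m ∷ u ∷ v ∷ []) sorted) critical (here refl) v<M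
... | c , here refl , v<v , _ = contradiction v<v (<-irrefl refl)
... | c , there (here refl) , _ , u+v≡m+M = u+v≡m+M

progression : ℕ → ℕ → ℕ → List ℕ
progression a d zero = []
progression a d (suc n) = a ∷ progression (a + d) d n

progression-∷ : ∀ {a b d xs} n → b ≡ a + d → xs ≡ progression b d n → a ∷ xs ≡ progression a d (suc n)
progression-∷ n refl refl = refl

∈-progression⁺ : ∀ a d {n j} → j < n → a + j * d ∈ progression a d n
∈-progression⁺ a d {suc n} {zero} _ = here (+-identityʳ a)
∈-progression⁺ a d {suc n} {suc j} j<n =
  there (subst (_∈ progression (a + d) d n) (+-assoc a d (j * d)) (∈-progression⁺ (a + d) d (s≤s⁻¹ j<n)))

∈-progression⁻ : ∀ a d n {b} → b ∈ progression a d n → ∃[ j ] (j < n × b ≡ a + j * d)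
∈-progression⁻ a d (suc n) (here refl) = 0 , s≤s z≤n , sym (+-identityʳ a)
∈-progression⁻ a d (suc n) (there b∈) =
  let j , j<n , b≡ = ∈-progression⁻ (a + d) d n b∈ in suc j , s≤s j<n , trans b≡ (+-assoc a d (j * d))

∈-progression-above : ∀ a d n {b} → b ∈ progression a d n → a < b → a + d ≤ b
∈-progression-above a d n b∈ a<b with ∈-progression⁻ a d n b∈
... | zero , _ , refl = contradiction (sym (+-identityʳ a)) (<⇒≢ a<b)
... | suc j , _ , refl = +-monoʳ-≤ a (m≤m+n d (j * d))

progression-maximum : ∀ a d n → Maximum (progression a d (suc n)) (a + n * d)
progression-maximum a d n =
  ∈-progression⁺ a d (n<1+n n) ,
  All.tabulate λ b∈ → let j , j<1+n , b≡ = ∈-progression⁻ a d (suc n) b∈ in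
    ≤-trans (≤-reflexive b≡) (+-monoʳ-≤ a (*-monoˡ-≤ d (s≤s⁻¹ j<1+n)))

critical⇒progression₅ : ∀ {x₁ x₂ x₃ x₄ x₅} → Sorted (x₁ ∷ x₂ ∷ x₃ ∷ x₄ ∷ x₅ ∷ []) →
  Critical (x₁ ∷ x₂ ∷ x₃ ∷ x₄ ∷ x₅ ∷ []) (x₁ ∷ x₂ ∷ x₃ ∷ x₄ ∷ x₅ ∷ []) →
  ∃[ d ] x₁ ∷ x₂ ∷ x₃ ∷ x₄ ∷ x₅ ∷ [] ≡ progression x₁ d 5
critical⇒progression₅ {x₁} {x₂} {x₃} {x₄} {x₅}
  sorted@((x₁<x₂ ∷ _) ∷ _ ∷ (x₃<x₄ ∷ x₃<x₅ ∷ []) ∷ (x₄<x₅ ∷ []) ∷ _) critical =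
  d , progression-∷ 4 x₂≡x₁+d (progression-∷ 3 x₃≡x₂+d (progression-∷ 2 x₄≡x₃+d (progression-∷ 1 x₅≡x₄+d refl)))
  where
  max : Maximum (x₁ ∷ x₂ ∷ x₃ ∷ x₄ ∷ x₅ ∷ []) x₅
  max = sorted-∷ʳ⇒maximum (x₁ ∷ x₂ ∷ x₃ ∷ x₄ ∷ []) sorted

  x₂+x₄≡x₁+x₅ : x₂ + x₄ ≡ x₁ + x₅
  x₂+x₄≡x₁+x₅ with critical⇒y+b≡x+c sorted max critical (there (here refl)) x₄<x₅
  ... | c , here refl , x₄<x₃ , _ = contradiction x₄<x₃ (<-asym x₃<x₄)
  ... | c , there (here refl) , x₄<x₄ , _ = contradiction x₄<x₄ (<-irrefl refl)
  ... | c , there (there (here refl)) , _ , x₂+x₄≡x₁+x₅ = x₂+x₄≡x₁+x₅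

  x₂+x₃≡x₁+x₄ : x₂ + x₃ ≡ x₁ + x₄
  x₂+x₃≡x₁+x₄ with critical⇒y+b≡x+c sorted max critical (here refl) x₃<x₅
  ... | c , here refl , x₃<x₃ , _ = contradiction x₃<x₃ (<-irrefl refl)
  ... | c , there (here refl) , _ , x₂+x₃≡x₁+x₄ = x₂+x₃≡x₁+x₄
  ... | c , there (there (here refl)) , _ , x₂+x₃≡x₁+x₅ =
    contradiction (+-cancelˡ-≡ x₂ x₃ x₄ (trans x₂+x₃≡x₁+x₅ (sym x₂+x₄≡x₁+x₅))) (<⇒≢ x₃<x₄)

  x₃+x₄≡x₂+x₅ : x₃ + x₄ ≡ x₂ + x₅
  x₃+x₄≡x₂+x₅ = critical⇒two-pairs (AllPairs.tail sorted) (critical-tail sorted critical)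

  d = x₂ ∸ x₁

  x₂≡x₁+d : x₂ ≡ x₁ + d
  x₂≡x₁+d = sym (m+[n∸m]≡n (<⇒≤ x₁<x₂))

  x₄≡x₃+d : x₄ ≡ x₃ + d
  x₄≡x₃+d = same-difference x₂≡x₁+d x₂+x₃≡x₁+x₄

  x₅≡x₄+d : x₅ ≡ x₄ + d
  x₅≡x₄+d = same-difference x₂≡x₁+d x₂+x₄≡x₁+x₅

  x₃≡x₂+d : x₃ ≡ x₂ + d
  x₃≡x₂+d = same-difference x₅≡x₄+d (trans (+-comm x₅ x₂) (trans (sym x₃+x₄≡x₂+x₅) (+-comm x₃ x₄)))

critical⇒progression-step : ∀ {x y d} n → Sorted (x ∷ y ∷ progression (y + d) d (2 + n)) →
  Critical (x ∷ y ∷ progression (y + d) d (2 + n)) (x ∷ y ∷ progression (y + d) d (2 + n)) → y ≡ x + d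
critical⇒progression-step {x} {y} {d} n sorted@((x<y ∷ _) ∷ (y<y+d ∷ _) ∷ _) critical = ≤-antisym y≤x+d x+d≤y
  where
  yt = progression (y + d) d (2 + n)
  M = y + d + suc n * d

  max-yt : Maximum yt M
  max-yt = progression-maximum (y + d) d (suc n)

  y≤M : y ≤ M
  y≤M = ≤-trans (m≤m+n y d) (m≤m+n (y + d) (suc n * d))

  max : Maximum (x ∷ y ∷ yt) M
  max = there (there (proj₁ max-yt)) , <⇒≤ (<-≤-trans x<y y≤M) ∷ y≤M ∷ proj₂ max-yt

  0<d : 0 < d
  0<d = +-cancelˡ-< y 0 d (subst (_< y + d) (sym (+-identityʳ y)) y<y+d)

  y≤x+d : y ≤ x + d
  y≤x+d with critical⇒y+b≡x+c sorted max critical (∈-progression⁺ (y + d) d (m<n+m n (s≤s z≤n)))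
                                (+-monoʳ-< (y + d) (m<n+m (n * d) 0<d))
  ... | c , c∈yt , _ , y+b≡x+c = +-cancelʳ-≤ (y + d + n * d) y (x + d) (begin
    y + (y + d + n * d)      ≡⟨ y+b≡x+c ⟩
    x + c                    ≤⟨ +-monoʳ-≤ x (All.lookup (proj₂ max-yt) c∈yt) ⟩
    x + M                    ≡⟨ arith x y d n ⟩
    x + d + (y + d + n * d)  ∎)
    where
    open ≤-Reasoning
    arith : ∀ x y d n → x + (y + d + suc n * d) ≡ x + d + (y + d + n * d)
    arith = solve-∀

  x+d≤y : x + d ≤ y
  x+d≤y with critical⇒y+b≡x+c sorted max critical (here refl) (m<m+n (y + d) (<-≤-trans 0<d (m≤m+n d (n * d))))
  ... | c , c∈yt , y+d<c , y+[y+d]≡x+c = +-cancelʳ-≤ (y + d) (x + d) y (begin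
    x + d + (y + d)          ≡⟨ +-assoc x d (y + d) ⟩
    x + (d + (y + d))        ≡⟨ cong (x +_) (+-comm d (y + d)) ⟩
    x + (y + d + d)          ≤⟨ +-monoʳ-≤ x (∈-progression-above (y + d) d (2 + n) c∈yt y+d<c) ⟩
    x + c                    ≡⟨ y+[y+d]≡x+c ⟨
    y + (y + d)              ∎)
    where open ≤-Reasoning

critical⇒progression : ∀ n {x xt} → length xt ≡ 4 + n → Sorted (x ∷ xt) → Critical (x ∷ xt) (x ∷ xt) →
  ∃[ d ] x ∷ xt ≡ progression x d (5 + n)
critical⇒progression zero {xt = _ ∷ _ ∷ _ ∷ _ ∷ []} _ = critical⇒progression₅
critical⇒progression (suc n) {x} {y ∷ z ∷ r} length≡ sorted critical
  with critical⇒progression n (suc-injective length≡) (AllPairs.tail sorted) (critical-tail sorted critical)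
... | d , tail≡ = d , progression-∷ (5 + n) y≡x+d tail≡
  where
  y≡x+d : y ≡ x + d
  y≡x+d = critical⇒progression-step (2 + n) (subst (Sorted ∘ (x ∷_)) tail≡ sorted)
            (subst (λ t → Critical (x ∷ t) (x ∷ t)) tail≡ critical)

module _ {A : Set} (_∙_ : A → A → A) where

  pairSums : List A → List A
  pairSums [] = []
  pairSums (x ∷ xs) = map (x ∙_) xs ++ pairSums xs

  ∈-pairSums : (∀ a b → a ∙ b ≡ b ∙ a) → ∀ {xs a b} → a ∈ xs → b ∈ xs → a ≢ b → a ∙ b ∈ pairSums xs
  ∈-pairSums comm (here refl) (here refl) a≢b = contradiction refl a≢b
  ∈-pairSums comm {a = a} (here refl) (there b∈) _ = ∈-++⁺ˡ (∈-map⁺ (a ∙_) b∈)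
  ∈-pairSums comm {b ∷ xs} {a} (there a∈) (here refl) _ =
    subst (_∈ pairSums (b ∷ xs)) (comm b a) (∈-++⁺ˡ (∈-map⁺ (b ∙_) a∈))
  ∈-pairSums comm {x ∷ xs} (there a∈) (there b∈) a≢b = ∈-++⁺ʳ (map (x ∙_) xs) (∈-pairSums comm a∈ b∈ a≢b)

length-pairSums-≤ : ∀ xs → length xs ≤ 3 → length (pairSums _+_ xs) ≤ length xs + length xs ∸ 3
length-pairSums-≤ [] _ = z≤n
length-pairSums-≤ (_ ∷ []) _ = z≤n
length-pairSums-≤ (_ ∷ _ ∷ []) _ = ≤-refl
length-pairSums-≤ (_ ∷ _ ∷ _ ∷ []) _ = ≤-refl
length-pairSums-≤ (_ ∷ _ ∷ _ ∷ _ ∷ _) (s≤s (s≤s (s≤s ())))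

increasing-indices-sum : ∀ {i j k} → i < j → j < k → ∃[ t ] (i + j ≡ suc t × t < k + k ∸ 3)
increasing-indices-sum {i} {suc j} {k} (s≤s i≤j) j<k = i + j , +-suc i j , m+n≤o⇒m≤o∸n (suc (i + j)) (begin
  suc (i + j) + 3  ≡⟨ arith i j ⟩
  2 + i + (2 + j)  ≤⟨ +-mono-≤ (≤-trans (s≤s (s≤s i≤j)) j<k) j<k ⟩
  k + k            ∎)
  where
  open ≤-Reasoning
  arith : ∀ i j → suc (i + j) + 3 ≡ 2 + i + (2 + j)
  arith = solve-∀

distinct-indices-sum : ∀ {i j k} → i < k → j < k → i ≢ j → ∃[ t ] (i + j ≡ suc t × t < k + k ∸ 3)
distinct-indices-sum {i} {j} i<k j<k i≢j with <-cmp i j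
... | tri< i<j _ _ = increasing-indices-sum i<j j<k
... | tri≈ _ i≡j _ = contradiction i≡j i≢j
... | tri> _ _ j<i = let t , j+i≡1+t , t< = increasing-indices-sum j<i i<k in t , trans (+-comm i j) j+i≡1+t , t<

-- Arithmetic in ℤ/pℤ

module _ {n : ℕ} where

  private
    p = suc n

  toℕ-[]ₚ : ∀ m (x : Fin p) → toℕ ([ m ]ₚ x) ≡ m % p
  toℕ-[]ₚ m x = toℕ-fromℕ< _

  toℕ-[]ₚ-≡ : ∀ {m c} (x : Fin p) → m ≡ c → c < p → toℕ ([ m ]ₚ x) ≡ c
  toℕ-[]ₚ-≡ {m} x refl m<p = trans (toℕ-[]ₚ m x) (m<n⇒m%n≡m m<p)

  toℕ-⊕ : ∀ (a b : Fin p) → toℕ (a ⊕ b) ≡ (toℕ a + toℕ b) % p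
  toℕ-⊕ a b = toℕ-[]ₚ (toℕ a + toℕ b) a

  toℕ-⊕· : ∀ (a : Fin p) i d → toℕ (a ⊕ i · d) ≡ (toℕ a + i * toℕ d) % p
  toℕ-⊕· a i d = toℕ-[]ₚ (toℕ a + i * toℕ d) a

  [m%p+n]%p≡[m+n]%p : ∀ m n → (m % p + n) % p ≡ (m + n) % p
  [m%p+n]%p≡[m+n]%p m n = begin
    (m % p + n) % p          ≡⟨ %-distribˡ-+ (m % p) n p ⟩
    (m % p % p + n % p) % p  ≡⟨ cong (λ z → (z + n % p) % p) (m%n%n≡m%n m p) ⟩
    (m % p + n % p) % p      ≡⟨ %-distribˡ-+ m n p ⟨
    (m + n) % p              ∎
    where open ≡-Reasoning

  [m+n%p]%p≡[m+n]%p : ∀ m n → (m + n % p) % p ≡ (m + n) % p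
  [m+n%p]%p≡[m+n]%p m n = begin
    (m + n % p) % p  ≡⟨ cong (_% p) (+-comm m (n % p)) ⟩
    (n % p + m) % p  ≡⟨ [m%p+n]%p≡[m+n]%p n m ⟩
    (n + m) % p      ≡⟨ cong (_% p) (+-comm n m) ⟩
    (m + n) % p      ∎
    where open ≡-Reasoning

  ⊕-comm : ∀ (a b : Fin p) → a ⊕ b ≡ b ⊕ a
  ⊕-comm a b = toℕ-injective (begin
    toℕ (a ⊕ b)          ≡⟨ toℕ-⊕ a b ⟩
    (toℕ a + toℕ b) % p  ≡⟨ cong (_% p) (+-comm (toℕ a) (toℕ b)) ⟩
    (toℕ b + toℕ a) % p  ≡⟨ toℕ-⊕ b a ⟨
    toℕ (b ⊕ a)          ∎)
    where open ≡-Reasoning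

  ⊕-exchange : ∀ (a c d : Fin p) → a ⊕ (c ⊕ d) ≡ (a ⊕ d) ⊕ c
  ⊕-exchange a c d = toℕ-injective (begin
    toℕ (a ⊕ (c ⊕ d))                  ≡⟨ toℕ-⊕ a (c ⊕ d) ⟩
    (toℕ a + toℕ (c ⊕ d)) % p          ≡⟨ cong (λ z → (toℕ a + z) % p) (toℕ-⊕ c d) ⟩
    (toℕ a + (toℕ c + toℕ d) % p) % p  ≡⟨ [m+n%p]%p≡[m+n]%p (toℕ a) (toℕ c + toℕ d) ⟩
    (toℕ a + (toℕ c + toℕ d)) % p      ≡⟨ cong (_% p) (arith (toℕ a) (toℕ c) (toℕ d)) ⟩
    (toℕ a + toℕ d + toℕ c) % p        ≡⟨ [m%p+n]%p≡[m+n]%p (toℕ a + toℕ d) (toℕ c) ⟨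
    ((toℕ a + toℕ d) % p + toℕ c) % p  ≡⟨ cong (λ z → (z + toℕ c) % p) (toℕ-⊕ a d) ⟨
    (toℕ (a ⊕ d) + toℕ c) % p          ≡⟨ toℕ-⊕ (a ⊕ d) c ⟨
    toℕ ((a ⊕ d) ⊕ c)                  ∎)
    where
    open ≡-Reasoning
    arith : ∀ a c d → a + (c + d) ≡ a + d + c
    arith = solve-∀

  ⊕-progression : ∀ (a d : Fin p) i j → ((a ⊕ i · d) ⊕ (a ⊕ j · d)) ≡ ((a ⊕ a) ⊕ (i + j) · d)
  ⊕-progression a d i j = toℕ-injective (begin
    toℕ ((a ⊕ i · d) ⊕ (a ⊕ j · d))          ≡⟨ toℕ-⊕ (a ⊕ i · d) (a ⊕ j · d) ⟩
    (toℕ (a ⊕ i · d) + toℕ (a ⊕ j · d)) % p  ≡⟨ cong₂ (λ u v → (u + v) % p) (toℕ-⊕· a i d) (toℕ-⊕· a j d) ⟩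
    ((α + i * δ) % p + (α + j * δ) % p) % p  ≡⟨ [m%p+n]%p≡[m+n]%p (α + i * δ) ((α + j * δ) % p) ⟩
    (α + i * δ + (α + j * δ) % p) % p        ≡⟨ [m+n%p]%p≡[m+n]%p (α + i * δ) (α + j * δ) ⟩
    (α + i * δ + (α + j * δ)) % p            ≡⟨ cong (_% p) (arith α δ i j) ⟩
    (α + α + (i + j) * δ) % p                ≡⟨ [m%p+n]%p≡[m+n]%p (α + α) ((i + j) * δ) ⟨
    ((α + α) % p + (i + j) * δ) % p          ≡⟨ cong (λ z → (z + (i + j) * δ) % p) (toℕ-⊕ a a) ⟨
    (toℕ (a ⊕ a) + (i + j) * δ) % p          ≡⟨ toℕ-⊕· (a ⊕ a) (i + j) d ⟨
    toℕ ((a ⊕ a) ⊕ (i + j) · d)              ∎)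
    where
    open ≡-Reasoning
    α = toℕ a
    δ = toℕ d
    arith : ∀ α δ i j → α + i * δ + (α + j * δ) ≡ α + α + (i + j) * δ
    arith = solve-∀

-- Subsets of ℤ/pℤ as sets of naturals

elements : ∀ {p} → Subset p → List ℕ
elements [] = []
elements (true ∷ T) = 0 ∷ map suc (elements T)
elements (false ∷ T) = map suc (elements T)

length-elements : ∀ {p} (T : Subset p) → length (elements T) ≡ ∣ T ∣
length-elements [] = refl
length-elements (true ∷ T) = cong suc (trans (length-map suc (elements T)) (length-elements T))
length-elements (false ∷ T) = trans (length-map suc (elements T)) (length-elements T)

elements-sorted : ∀ {p} (T : Subset p) → Sorted (elements T)
elements-sorted [] = []
elements-sorted (true ∷ T) =
  All.map⁺ (All.universal (λ _ → s≤s z≤n) (elements T)) ∷ AllPairs.map⁺ (AllPairs.map s≤s (elements-sorted T))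
elements-sorted (false ∷ T) = AllPairs.map⁺ (AllPairs.map s≤s (elements-sorted T))

∈-elements⁺ : ∀ {p} {T : Subset p} {x} → x ∈ₛ T → toℕ x ∈ elements T
∈-elements⁺ {T = true ∷ T} here = here refl
∈-elements⁺ {T = true ∷ T} (there x∈) = there (∈-map⁺ suc (∈-elements⁺ x∈))
∈-elements⁺ {T = false ∷ T} (there x∈) = ∈-map⁺ suc (∈-elements⁺ x∈)

∈-elements⁻ : ∀ {p} {T : Subset p} {k} → k ∈ elements T → ∃[ x ] (toℕ x ≡ k × x ∈ₛ T)
∈-map-suc-elements⁻ : ∀ {p b} {T : Subset p} {k} → k ∈ map suc (elements T) → ∃[ x ] (toℕ x ≡ k × x ∈ₛ (b ∷ T))

∈-elements⁻ {T = true ∷ T} (here refl) = Fin.zero , refl , here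
∈-elements⁻ {T = true ∷ T} (there k∈) = ∈-map-suc-elements⁻ k∈
∈-elements⁻ {T = false ∷ T} k∈ = ∈-map-suc-elements⁻ k∈

∈-map-suc-elements⁻ k∈ with ∈-map⁻ suc k∈
... | j , j∈ , refl = let x , toℕx≡j , x∈ = ∈-elements⁻ j∈ in Fin.suc x , cong suc toℕx≡j , there x∈

∈ₛ⇔∈-elements : ∀ {p} {T : Subset p} {x} → x ∈ₛ T ⇔ toℕ x ∈ elements T
∈ₛ⇔∈-elements {T = T} = mk⇔ ∈-elements⁺ λ x∈ →
  let y , toℕy≡toℕx , y∈ = ∈-elements⁻ x∈ in subst (_∈ₛ T) (toℕ-injective toℕy≡toℕx) y∈

elements-⊆⇒⊆ : ∀ {p} {A B : Subset p} → elements A ⊆ elements B → A Subset.⊆ B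
elements-⊆⇒⊆ ⊆ = Equivalence.from ∈ₛ⇔∈-elements ∘ ⊆ ∘ Equivalence.to ∈ₛ⇔∈-elements

elements≡map⇒∈ₛ⇔∈ : ∀ {p} {T : Subset p} (xs : List (Fin p)) → elements T ≡ map toℕ xs → ∀ {x} → x ∈ₛ T ⇔ x ∈ xs
elements≡map⇒∈ₛ⇔∈ {T = T} xs T≡xs {x} = mk⇔ to from
  where
  to : x ∈ₛ T → x ∈ xs
  to x∈ with ∈-map⁻ toℕ (subst (toℕ x ∈_) T≡xs (∈-elements⁺ x∈))
  ... | y , y∈ , toℕx≡toℕy = subst (_∈ xs) (sym (toℕ-injective toℕx≡toℕy)) y∈
  from : x ∈ xs → x ∈ₛ T
  from x∈ = Equivalence.from ∈ₛ⇔∈-elements (subst (toℕ x ∈_) (sym T≡xs) (∈-map⁺ toℕ x∈))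

∈-elements⇒< : ∀ {p} {T : Subset p} {k} → k ∈ elements T → k < p
∈-elements⇒< {T = T} k∈ = let x , toℕx≡k , _ = ∈-elements⁻ {T = T} k∈ in subst (_< _) toℕx≡k (toℕ<n x)

isMax⇒maximum : ∀ {p} {T : Subset p} {m} → IsMax T m → Maximum (elements T) (toℕ m)
isMax⇒maximum (m∈ , below) = ∈-elements⁺ m∈ , All.tabulate λ k∈ →
  let x , toℕx≡k , x∈ = ∈-elements⁻ k∈ in subst (_≤ _) toℕx≡k (below x x∈)

∣∣≤length : ∀ {p} {T : Subset p} {zs} → elements T ⊆ zs → ∣ T ∣ ≤ length zs
∣∣≤length {T = T} ⊆zs = subst (_≤ _) (length-elements T) (unique-⊆⇒length≤ (sorted⇒unique (elements-sorted T)) ⊆zs)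

length≤∣∣ : ∀ {p} {T : Subset p} {zs} → Unique zs → zs ⊆ elements T → length zs ≤ ∣ T ∣
length≤∣∣ {T = T} unique ⊆T = subst (_ ≤_) (length-elements T) (unique-⊆⇒length≤ unique ⊆T)

∣∣≤length-cover : ∀ {p} {T : Subset p} (xs : List (Fin p)) → (∀ {x} → x ∈ₛ T → x ∈ xs) → ∣ T ∣ ≤ length xs
∣∣≤length-cover {T = T} xs covers = subst (_ ≤_) (length-map toℕ xs) (∣∣≤length {T = T} ⊆)
  where
  ⊆ : elements T ⊆ map toℕ xs
  ⊆ k∈ = let x , toℕx≡k , x∈ = ∈-elements⁻ k∈ in subst (_∈ _) toℕx≡k (∈-map⁺ toℕ (covers x∈))

∈-+̂⁻ : ∀ {p} {A B : Subset p} {x} → x ∈ₛ A +̂ B → RSum A B x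
∈-+̂⁻ {A = A} {B} {x} x∈
  with RSum? A B x | trans (sym (lookup∘tabulate (λ y → does (RSum? A B y)) x)) ([]=⇒lookup x∈)
... | yes sum | _ = sum
... | no _ | ()

∈-+̂⁺ : ∀ {p} {A B : Subset p} {x} → RSum A B x → x ∈ₛ A +̂ B
∈-+̂⁺ {A = A} {B} {x} sum =
  lookup⇒[]= x (A +̂ B) (trans (lookup∘tabulate (λ y → does (RSum? A B y)) x) (dec-true (RSum? A B x) sum))

NoWrap : ∀ {p} → Subset p → Subset p → Set
NoWrap {p} A B = ∀ {a b} → a ∈ elements A → b ∈ elements B → a + b < p

module _ {n} (A B : Subset (suc n)) (no-wrap : NoWrap A B) where

  ∈-elements-+̂⁺ : ∀ {s} → RestrictedSum (elements A) (elements B) s → s ∈ elements (A +̂ B)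
  ∈-elements-+̂⁺ (a , b , a∈ , b∈ , a≢b , refl) with ∈-elements⁻ {T = A} a∈ | ∈-elements⁻ {T = B} b∈
  ... | x , refl , x∈ | y , refl , y∈ =
    subst (_∈ elements (A +̂ B)) (toℕ-[]ₚ-≡ x refl (no-wrap a∈ b∈))
          (∈-elements⁺ (∈-+̂⁺ (x , y , x∈ , y∈ , a≢b ∘ cong toℕ , refl)))

  ∈-elements-+̂⁻ : ∀ {s} → s ∈ elements (A +̂ B) → RestrictedSum (elements A) (elements B) s
  ∈-elements-+̂⁻ s∈ with ∈-elements⁻ {T = A +̂ B} s∈
  ... | z , refl , z∈ with ∈-+̂⁻ z∈
  ...   | x , y , x∈ , y∈ , x≢y , refl =
    toℕ x , toℕ y , ∈-elements⁺ x∈ , ∈-elements⁺ y∈ , x≢y ∘ toℕ-injective ,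
    toℕ-[]ₚ-≡ x refl (no-wrap (∈-elements⁺ x∈) (∈-elements⁺ y∈))

  +̂-lower-bound : ∀ {M} → 0 < ∣ A ∣ → Maximum (elements B) M → ∣ A ∣ + ∣ B ∣ ≤ ∣ A +̂ B ∣ + 3
  +̂-lower-bound 0<∣A∣ max = begin
    ∣ A ∣ + ∣ B ∣
      ≡⟨ cong₂ _+_ (length-elements A) (length-elements B) ⟨
    length (elements A) + length (elements B)
      ≤⟨ restrictedSums-lower-bound (elements-sorted A) (elements-sorted B) max
           (subst (0 <_) (sym (length-elements A)) 0<∣A∣) ∈-elements-+̂⁺ ⟩
    length (elements (A +̂ B)) + 3
      ≡⟨ cong (_+ 3) (length-elements (A +̂ B)) ⟩
    ∣ A +̂ B ∣ + 3
      ∎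
    where open ≤-Reasoning

  +̂-critical : 3 ≤ ∣ A ∣ + ∣ B ∣ → ∣ A +̂ B ∣ ≡ ∣ A ∣ + ∣ B ∣ ∸ 3 → Critical (elements A) (elements B)
  +̂-critical 3≤ ∣A+̂B∣≡ {L} unique sums = begin
    length L + 3                               ≤⟨ +-monoˡ-≤ 3 (length≤∣∣ {T = A +̂ B} unique (∈-elements-+̂⁺ ∘ All.lookup sums)) ⟩
    ∣ A +̂ B ∣ + 3                              ≡⟨ cong (_+ 3) ∣A+̂B∣≡ ⟩
    ∣ A ∣ + ∣ B ∣ ∸ 3 + 3                      ≡⟨ m∸n+n≡m 3≤ ⟩
    ∣ A ∣ + ∣ B ∣                              ≡⟨ cong₂ _+_ (length-elements A) (length-elements B) ⟨
    length (elements A) + length (elements B)  ∎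
    where open ≤-Reasoning

+̂-small-upper-bound : ∀ {n} (A : Subset (suc n)) → NoWrap A A → ∣ A ∣ ≤ 3 → ∣ A +̂ A ∣ ≤ ∣ A ∣ + ∣ A ∣ ∸ 3
+̂-small-upper-bound A no-wrap ∣A∣≤3 = begin
  ∣ A +̂ A ∣                                      ≤⟨ ∣∣≤length {T = A +̂ A} (sum∈pairSums ∘ ∈-elements-+̂⁻ A A no-wrap) ⟩
  length (pairSums _+_ (elements A))             ≤⟨ length-pairSums-≤ (elements A) (subst (_≤ 3) (sym (length-elements A)) ∣A∣≤3) ⟩
  length (elements A) + length (elements A) ∸ 3  ≡⟨ cong (λ k → k + k ∸ 3) (length-elements A) ⟩
  ∣ A ∣ + ∣ A ∣ ∸ 3                              ∎
  where
  open ≤-Reasoning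
  sum∈pairSums : ∀ {s} → RestrictedSum (elements A) (elements A) s → s ∈ pairSums _+_ (elements A)
  sum∈pairSums (a , b , a∈ , b∈ , a≢b , refl) = ∈-pairSums _+_ +-comm a∈ b∈ a≢b

∈-four⇔ : ∀ {A : Set} {x a b c d : A} → x ∈ a ∷ b ∷ c ∷ d ∷ [] ⇔ (x ≡ a ⊎ x ≡ b ⊎ x ≡ c ⊎ x ≡ d)
∈-four⇔ = mk⇔ to from
  where
  to : ∀ {A : Set} {x a b c d : A} → x ∈ a ∷ b ∷ c ∷ d ∷ [] → x ≡ a ⊎ x ≡ b ⊎ x ≡ c ⊎ x ≡ d
  to (here x≡a) = inj₁ x≡a
  to (there (here x≡b)) = inj₂ (inj₁ x≡b)
  to (there (there (here x≡c))) = inj₂ (inj₂ (inj₁ x≡c))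
  to (there (there (there (here x≡d)))) = inj₂ (inj₂ (inj₂ x≡d))
  from : ∀ {A : Set} {x a b c d : A} → x ≡ a ⊎ x ≡ b ⊎ x ≡ c ⊎ x ≡ d → x ∈ a ∷ b ∷ c ∷ d ∷ []
  from (inj₁ x≡a) = here x≡a
  from (inj₂ (inj₁ x≡b)) = there (here x≡b)
  from (inj₂ (inj₂ (inj₁ x≡c))) = there (there (here x≡c))
  from (inj₂ (inj₂ (inj₂ x≡d))) = there (there (there (here x≡d)))

+̂-two-pairs-upper-bound : ∀ {n} {A : Subset (suc n)} → IsTwoPairs A → ∣ A +̂ A ∣ ≤ 5
+̂-two-pairs-upper-bound {A = A} (a , c , d , A≡) = ∣∣≤length-cover sums covers
  where
  sums = a ⊕ (a ⊕ d) ∷ a ⊕ c ∷ (a ⊕ d) ⊕ c ∷ (a ⊕ d) ⊕ (c ⊕ d) ∷ c ⊕ (c ⊕ d) ∷ []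

  merge : ∀ {s} → s ∈ pairSums _⊕_ (a ∷ a ⊕ d ∷ c ∷ c ⊕ d ∷ []) → s ∈ sums
  merge (here s≡) = here s≡
  merge (there (here s≡)) = there (here s≡)
  merge (there (there (here s≡))) = there (there (here (trans s≡ (⊕-exchange a c d))))
  merge (there (there (there s∈))) = there (there s∈)

  covers : ∀ {s} → s ∈ₛ A +̂ A → s ∈ sums
  covers s∈ with ∈-+̂⁻ s∈
  ... | u , v , u∈ , v∈ , u≢v , refl =
    merge (∈-pairSums _⊕_ ⊕-comm (Equivalence.from ∈-four⇔ (Equivalence.to (A≡ u) u∈))
                                 (Equivalence.from ∈-four⇔ (Equivalence.to (A≡ v) v∈)) u≢v)

+̂-progression-upper-bound : ∀ {n} {A : Subset (suc n)} k → IsAP k A → ∣ A +̂ A ∣ ≤ k + k ∸ 3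
+̂-progression-upper-bound {A = A} k (a , d , A≡) =
  subst (_ ≤_) (length-applyUpTo sum (k + k ∸ 3)) (∣∣≤length-cover (applyUpTo sum (k + k ∸ 3)) covers)
  where
  sum : ℕ → Fin _
  sum t = (a ⊕ a) ⊕ suc t · d

  covers : ∀ {s} → s ∈ₛ A +̂ A → s ∈ applyUpTo sum (k + k ∸ 3)
  covers s∈ with ∈-+̂⁻ s∈
  ... | u , v , u∈ , v∈ , u≢v , refl with Equivalence.to (A≡ u) u∈ | Equivalence.to (A≡ v) v∈
  ...   | i , i<k , refl | j , j<k , refl =
    let t , i+j≡1+t , t< = distinct-indices-sum i<k j<k (u≢v ∘ cong (a ⊕_· d)) in
    subst (_∈ applyUpTo sum (k + k ∸ 3)) (sym (trans (⊕-progression a d i j) (cong ((a ⊕ a) ⊕_· d) i+j≡1+t)))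
          (∈-applyUpTo⁺ sum t<)

two-pairs-transfer : ∀ {n} (A : Subset (suc n)) {m u v M} →
  elements A ≡ m ∷ u ∷ v ∷ M ∷ [] → u + v ≡ m + M → IsTwoPairs A
two-pairs-transfer {n} A {m} {u} {v} {M} A≡ u+v≡m+M =
  fm , fv , δ , λ x → ⇔-trans (elements≡map⇒∈ₛ⇔∈ (fm ∷ fm ⊕ δ ∷ fv ∷ fv ⊕ δ ∷ []) A≡fs) ∈-four⇔
  where
  bound : ∀ {k} → k ∈ m ∷ u ∷ v ∷ M ∷ [] → k < suc n
  bound k∈ = ∈-elements⇒< {T = A} (subst (_ ∈_) (sym A≡) k∈)

  m<u : m < u
  m<u with subst Sorted A≡ (elements-sorted A)
  ... | (m<u ∷ _) ∷ _ = m<u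

  d = u ∸ m

  u≡m+d : u ≡ m + d
  u≡m+d = sym (m+[n∸m]≡n (<⇒≤ m<u))

  fm = fromℕ< (bound (here refl))
  fv = fromℕ< (bound (there (there (here refl))))
  δ = fromℕ< (≤-<-trans (m∸n≤m u m) (bound (there (here refl))))

  toℕ-shift : ∀ {a c} (fa : Fin (suc n)) → toℕ fa ≡ a → c ≡ a + d → c < suc n → toℕ (fa ⊕ δ) ≡ c
  toℕ-shift fa toℕfa≡a c≡a+d = toℕ-[]ₚ-≡ fa (trans (cong₂ _+_ toℕfa≡a (toℕ-fromℕ< _)) (sym c≡a+d))

  A≡fs : elements A ≡ map toℕ (fm ∷ fm ⊕ δ ∷ fv ∷ fv ⊕ δ ∷ [])
  A≡fs = trans A≡ (sym (cong₂ _∷_ (toℕ-fromℕ< _)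
                        (cong₂ _∷_ (toℕ-shift fm (toℕ-fromℕ< _) u≡m+d (bound (there (here refl))))
                        (cong₂ _∷_ (toℕ-fromℕ< _)
                        (cong (_∷ []) (toℕ-shift fv (toℕ-fromℕ< _) (same-difference u≡m+d u+v≡m+M)
                                                    (bound (there (there (there (here refl)))))))))))

progression-transfer : ∀ {n} (A : Subset (suc n)) {a d k} → 1 < k → elements A ≡ progression a d k → IsAP k A
progression-transfer {n} A {a} {d} {k} 1<k A≡ = fa , δ , λ x → mk⇔ to from
  where
  term∈ : ∀ {j} → j < k → a + j * d ∈ elements A
  term∈ j<k = subst (_ ∈_) (sym A≡) (∈-progression⁺ a d j<k)

  term< : ∀ {j} → j < k → a + j * d < suc n
  term< j<k = ∈-elements⇒< {T = A} (term∈ j<k)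

  fa = fromℕ< (≤-<-trans (m≤m+n a 0) (term< (<-trans (s≤s z≤n) 1<k)))
  δ = fromℕ< (≤-<-trans (≤-trans (m≤m+n d 0) (m≤n+m (d + 0) a)) (term< 1<k))

  toℕ-term : ∀ {j} → j < k → toℕ (fa ⊕ j · δ) ≡ a + j * d
  toℕ-term {j} j<k = toℕ-[]ₚ-≡ fa (cong₂ (λ α δ → α + j * δ) (toℕ-fromℕ< _) (toℕ-fromℕ< _)) (term< j<k)

  to : ∀ {x} → x ∈ₛ A → ∃[ j ] (j < k × x ≡ fa ⊕ j · δ)
  to {x} x∈ with ∈-progression⁻ a d k (subst (toℕ x ∈_) A≡ (∈-elements⁺ x∈))
  ... | j , j<k , toℕx≡ = j , j<k , toℕ-injective (trans toℕx≡ (sym (toℕ-term j<k)))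

  from : ∀ {x} → ∃[ j ] (j < k × x ≡ fa ⊕ j · δ) → x ∈ₛ A
  from (j , j<k , refl) = Equivalence.from ∈ₛ⇔∈-elements (subst (_∈ elements A) (sym (toℕ-term j<k)) (term∈ j<k))

CriticalShape : ∀ {p} → Subset p → Set
CriticalShape A = (∣ A ∣ ≡ 2 ⊎ ∣ A ∣ ≡ 3) ⊎ (∣ A ∣ ≡ 4 × IsTwoPairs A) ⊎ (∣ A ∣ ≥ 5 × IsAP ∣ A ∣ A)

critical⇒shape : ∀ {n} (A : Subset (suc n)) → 2 ≤ ∣ A ∣ → Critical (elements A) (elements A) → CriticalShape A
critical⇒shape A 2≤∣A∣ critical = classify (elements A) refl (elements-sorted A) critical
  where
  ∣A∣≡ : ∀ {xs} → elements A ≡ xs → ∣ A ∣ ≡ length xs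
  ∣A∣≡ A≡xs = trans (sym (length-elements A)) (cong length A≡xs)

  classify : ∀ xs → elements A ≡ xs → Sorted xs → Critical xs xs → CriticalShape A
  classify [] A≡ _ _ = contradiction (subst (2 ≤_) (∣A∣≡ A≡) 2≤∣A∣) λ ()
  classify (_ ∷ []) A≡ _ _ = contradiction (subst (2 ≤_) (∣A∣≡ A≡) 2≤∣A∣) λ { (s≤s ()) }
  classify (_ ∷ _ ∷ []) A≡ _ _ = inj₁ (inj₁ (∣A∣≡ A≡))
  classify (_ ∷ _ ∷ _ ∷ []) A≡ _ _ = inj₁ (inj₂ (∣A∣≡ A≡))
  classify (_ ∷ _ ∷ _ ∷ _ ∷ []) A≡ sorted critical =
    inj₂ (inj₁ (∣A∣≡ A≡ , two-pairs-transfer A A≡ (critical⇒two-pairs sorted critical)))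
  classify (_ ∷ _ ∷ _ ∷ _ ∷ _ ∷ r) A≡ sorted critical =
    let d , xs≡ = critical⇒progression (length r) refl sorted critical in
    inj₂ (inj₂ (subst (5 ≤_) (sym (∣A∣≡ A≡)) (s≤s (s≤s (s≤s (s≤s (s≤s z≤n))))) ,
                subst (λ k → IsAP k A) (sym (∣A∣≡ A≡)) (progression-transfer A (s≤s (s≤s z≤n)) (trans A≡ xs≡))))

theorem5 : (p : ℕ) → Prime p → (A B : Subset p) →
    ∣ A ∣ ≥ 2 → ∣ B ∣ ≥ 2 → p ≥ ∣ A ∣ + ∣ B ∣ ∸ 2 →
    (∃[ mA ] ∃[ mB ] (IsMax A mA × IsMax B mB × toℕ mA + toℕ mB < p)) →
    (∣ A +̂ B ∣ ≡ ∣ A ∣ + ∣ B ∣ ∸ 3) ⇔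
      (A ≡ B × ((∣ A ∣ ≡ 2 ⊎ ∣ A ∣ ≡ 3)
               ⊎ (∣ A ∣ ≡ 4 × IsTwoPairs A)
               ⊎ (∣ A ∣ ≥ 5 × IsAP ∣ A ∣ A)))
theorem5 zero _ [] [] () _ _ _
theorem5 (suc n) _ A B 2≤∣A∣ 2≤∣B∣ _ (mA , mB , isMax-A , isMax-B , mA+mB<p) = mk⇔ forward backward
  where
  max-A = isMax⇒maximum isMax-A
  max-B = isMax⇒maximum isMax-B

  no-wrap : NoWrap A B
  no-wrap a∈ b∈ = ≤-<-trans (+-mono-≤ (All.lookup (proj₂ max-A) a∈) (All.lookup (proj₂ max-B) b∈)) mA+mB<p

  forward : ∣ A +̂ B ∣ ≡ ∣ A ∣ + ∣ B ∣ ∸ 3 → A ≡ B × CriticalShape A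
  forward ∣A+̂B∣≡ = A≡B , critical⇒shape A 2≤∣A∣ (subst (Critical (elements A) ∘ elements) (sym A≡B) critical)
    where
    critical = +̂-critical A B no-wrap (+-mono-≤ (≤-trans (n≤1+n 1) 2≤∣A∣) 2≤∣B∣) ∣A+̂B∣≡
    A≡B = ⊆-antisym
      (elements-⊆⇒⊆ (critical⇒⊆ (elements-sorted A) (elements-sorted B) max-A max-B critical))
      (elements-⊆⇒⊆ (critical⇒⊆ (elements-sorted B) (elements-sorted A) max-B max-A (critical-sym critical)))

  backward : A ≡ B × CriticalShape A → ∣ A +̂ B ∣ ≡ ∣ A ∣ + ∣ B ∣ ∸ 3
  backward (refl , shape) = ≤-antisym (upper shape) (m≤n+o⇒m∸n≤o (∣ A ∣ + ∣ A ∣) 3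
    (subst (∣ A ∣ + ∣ A ∣ ≤_) (+-comm ∣ A +̂ A ∣ 3) (+̂-lower-bound A A no-wrap (≤-trans (n≤1+n 1) 2≤∣A∣) max-A)))
    where
    upper : CriticalShape A → ∣ A +̂ A ∣ ≤ ∣ A ∣ + ∣ A ∣ ∸ 3
    upper (inj₁ (inj₁ ∣A∣≡2)) = +̂-small-upper-bound A no-wrap (≤-trans (≤-reflexive ∣A∣≡2) (n≤1+n 2))
    upper (inj₁ (inj₂ ∣A∣≡3)) = +̂-small-upper-bound A no-wrap (≤-reflexive ∣A∣≡3)
    upper (inj₂ (inj₁ (∣A∣≡4 , two-pairs))) =
      subst (λ k → ∣ A +̂ A ∣ ≤ k + k ∸ 3) (sym ∣A∣≡4) (+̂-two-pairs-upper-bound two-pairs)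
    upper (inj₂ (inj₂ (_ , progression))) = +̂-progression-upper-bound ∣ A ∣ progression
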